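{- Let $s\ge 2$ and let $w$ be a nonempty word over $\Sigma_s$ such that $\mathcal{G}(w)$ is connected. Then the diameter of $\mathcal{G}(w)$ is at most $3s-3$.
   Context: $\Sigma_s$ denotes the ordered alphabet $\{a_1<a_2<\dots<a_s\}$. For a nonempty word $w=w_1\cdots w_n$ over $\Sigma_s$, the Parikh graph $\mathcal{G}(w)$ is the simple undirected graph on $\{1,\dots,n\}$ where, for $i<j$, $i$ and $j$ are adjacent iff $w_i=a_k$ and $w_j=a_{k+1}$ for some $1\le k\le s-1$. -}

module Defs where

open import Data.Nat using (ℕ; zero; suc; _+_; _<_; _≤_)
open import Data.Fin using (Fin; toℕ)
open import Data.Vec using (Vec; lookup)
open import Data.Product using (_×_; ∃-syntax)
open import Data.Sum using (_⊎_)
open import Relation.Binary.PropositionalEquality using (_≡_)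

-- A word of length n over Σ_s = {a_1 < … < a_s} is a Vec (Fin s) n;
-- the letter a_k is represented by the Fin s element with toℕ = k - 1.
Word : ℕ → ℕ → Set
Word s n = Vec (Fin s) n

Succ : ∀ {s} → Fin s → Fin s → Set
Succ x y = toℕ y ≡ suc (toℕ x)

ParikhArc : ∀ {s n} → Word s n → Fin n → Fin n → Set
ParikhArc w i j = toℕ i < toℕ j × Succ (lookup w i) (lookup w j)

-- Edge relation of the (undirected, simple) Parikh graph G(w) on positions.
ParikhAdj : ∀ {s n} → Word s n → Fin n → Fin n → Set
ParikhAdj w i j = ParikhArc w i j ⊎ ParikhArc w j i

data Walk {n : ℕ} (E : Fin n → Fin n → Set) : Fin n → Fin n → ℕ → Set where
  here : ∀ {i} → Walk E i i 0
  step : ∀ {i j l k} → E i j → Walk E j l k → Walk E i l (suc k)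

DistLe : ∀ {n} → (Fin n → Fin n → Set) → Fin n → Fin n → ℕ → Set
DistLe E i j d = ∃[ k ] (k ≤ d × Walk E i j k)

Connected : ∀ {n} → (Fin n → Fin n → Set) → Set
Connected E = ∀ i j → ∃[ k ] Walk E i j k

DiameterLe : ∀ {n} → (Fin n → Fin n → Set) → ℕ → Set
DiameterLe E d = ∀ i j → DistLe E i j d

module Submission where

-- Proof idea.  Call c the level of an edge of G(w) whose endpoints carry the
-- letters a_(c+1) and a_(c+2) (levels are 0-based, as in Defs).  Two facts
-- drive the bound:
--
--  * (crossings-close) any two vertices that are endpoints of edges of the
--    same level c are at distance at most 3: an earlier a_(c+1) is adjacent
--    to every later a_(c+2), and the order of four such positions always
--    leaves a path of length ≤ 3;
--  * (last-crossing) a walk whose letters stay in a band [lo, hi] and which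
--    starts on an edge of level c either stays on one side of that level or
--    crosses it a last time, so from some endpoint of a level-c edge it
--    continues inside [lo, c] or inside [c+1, hi].
--
-- Hence a walk in a band of width k can be replaced by a walk of length at
-- most 3k (band-shortcut, by induction on k): jump in ≤ 3 steps to the last
-- crossing of the first edge's level and recurse in a strictly narrower band.
-- Every walk lies in the band [0, s-1], which gives diameter ≤ 3(s-1).

open import Defs
open import Data.Nat using (ℕ; zero; suc; _+_; _≤_; _<_; _*_; _∸_; z≤n; s≤s; s≤s⁻¹)
open import Data.Nat.Properties
open import Data.Fin using (Fin; toℕ)
open import Data.Fin.Properties using (toℕ<n)
open import Data.Vec using (lookup)
open import Data.Product using (_×_; _,_; proj₁; proj₂; ∃-syntax; Σ)
open import Data.Sum using (_⊎_; inj₁; inj₂)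
open import Relation.Nullary using (yes; no; contradiction)
open import Relation.Binary.PropositionalEquality

_++ʷ_ : ∀ {n} {E : Fin n → Fin n → Set} {i j l k k′} →
        Walk E i j k → Walk E j l k′ → Walk E i l (k + k′)
here     ++ʷ q = q
step e p ++ʷ q = step e (p ++ʷ q)

dist-trans : ∀ {n} {E : Fin n → Fin n → Set} {i j l d d′} →
             DistLe E i j d → DistLe E j l d′ → DistLe E i l (d + d′)
dist-trans (k , k≤d , p) (k′ , k′≤d′ , q) = k + k′ , +-mono-≤ k≤d k′≤d′ , p ++ʷ q

dist-weaken : ∀ {n} {E : Fin n → Fin n → Set} {i j d d′} →
              d ≤ d′ → DistLe E i j d → DistLe E i j d′
dist-weaken d≤d′ (k , k≤d , p) = k , ≤-trans k≤d d≤d′ , p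

module ParikhGraph {s n : ℕ} (w : Word s n) where

  E : Fin n → Fin n → Set
  E = ParikhAdj w

  L : Fin n → ℕ
  L i = toℕ (lookup w i)

  P : Fin n → ℕ
  P i = toℕ i

  adj-sym : ∀ {a b} → E a b → E b a
  adj-sym (inj₁ arc) = inj₂ arc
  adj-sym (inj₂ arc) = inj₁ arc

  record Crossing (c : ℕ) : Set where
    field
      tail head  : Fin n
      ordered    : P tail < P head
      tail-level : L tail ≡ c
      head-level : L head ≡ suc c
  open Crossing

  OnCrossing : ℕ → Fin n → Set
  OnCrossing c x = Σ (Crossing c) λ a → x ≡ tail a ⊎ x ≡ head a

  arc-crossing : ∀ {u v} → ParikhArc w u v → Crossing (L u)
  arc-crossing {u} {v} (lt , sc) = record
    { tail = u ; head = v ; ordered = lt ; tail-level = refl ; head-level = sc }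

  link : ∀ {c} (a b : Crossing c) → P (tail a) < P (head b) → E (tail a) (head b)
  link a b lt = inj₁ (lt , trans (head-level b) (cong suc (sym (tail-level a))))

  link˘ : ∀ {c} (a b : Crossing c) → P (tail a) < P (head b) → E (head b) (tail a)
  link˘ a b lt = adj-sym (link a b lt)

  path1 : ∀ {x y} → E x y → DistLe E x y 3
  path1 e = 1 , s≤s z≤n , step e here

  path2 : ∀ {x y z} → E x y → E y z → DistLe E x z 3
  path2 e f = 2 , s≤s (s≤s z≤n) , step e (step f here)

  path3 : ∀ {x y z t} → E x y → E y z → E z t → DistLe E x t 3
  path3 e f g = 3 , ≤-refl , step e (step f (step g here))

  -- Key lemma: endpoints of two edges of the same level are at distance ≤ 3.
  -- Two tails meet at the later head, two heads at the earlier tail; a tail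
  -- and a head are adjacent unless the head comes first, when the positions
  -- tail b < head b ≤ tail a < head a give a path of length 3.
  crossings-close : ∀ {c x y} → OnCrossing c x → OnCrossing c y → DistLe E x y 3
  crossings-close (a , inj₁ refl) (b , inj₁ refl) with ≤-total (P (head a)) (P (head b))
  ... | inj₁ ha≤hb = path2 (link a b (<-≤-trans (ordered a) ha≤hb)) (link˘ b b (ordered b))
  ... | inj₂ hb≤ha = path2 (link a a (ordered a)) (link˘ b a (<-≤-trans (ordered b) hb≤ha))
  crossings-close (a , inj₂ refl) (b , inj₂ refl) with ≤-total (P (tail a)) (P (tail b))
  ... | inj₁ ta≤tb = path2 (link˘ a a (ordered a)) (link a b (≤-<-trans ta≤tb (ordered b)))
  ... | inj₂ tb≤ta = path2 (link˘ b a (≤-<-trans tb≤ta (ordered a))) (link b b (ordered b))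
  crossings-close (a , inj₁ refl) (b , inj₂ refl) with P (tail a) <? P (head b)
  ... | yes ta<hb = path1 (link a b ta<hb)
  ... | no ta≮hb  = path3 (link a a (ordered a))
                          (link˘ b a (<-trans (ordered b) (≤-<-trans (≮⇒≥ ta≮hb) (ordered a))))
                          (link b b (ordered b))
  crossings-close (a , inj₂ refl) (b , inj₁ refl) with P (tail b) <? P (head a)
  ... | yes tb<ha = path1 (link˘ b a tb<ha)
  ... | no tb≮ha  = path3 (link˘ a a (ordered a))
                          (link a b (<-trans (ordered a) (≤-<-trans (≮⇒≥ tb≮ha) (ordered b))))
                          (link˘ b b (ordered b))

  edge-across : ∀ {a b c} → E a b → L a ≤ c → c < L b → OnCrossing c a × OnCrossing c b
  edge-across {a} {b} {c} (inj₁ (lt , sc)) la≤c c<lb =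
    (crossing , inj₁ refl) , (crossing , inj₂ refl)
    where
    la≡c : L a ≡ c
    la≡c = ≤-antisym la≤c (s≤s⁻¹ (subst (c <_) sc c<lb))
    crossing : Crossing c
    crossing = record { tail = a ; head = b ; ordered = lt
                      ; tail-level = la≡c ; head-level = trans sc (cong suc la≡c) }
  edge-across {a} {b} {c} (inj₂ (_ , sc)) la≤c c<lb = contradiction lb<lb (<-irrefl refl)
    where
    open ≤-Reasoning
    lb<lb : L b < L b
    lb<lb = begin-strict
      L b      <⟨ n<1+n (L b) ⟩
      suc (L b) ≡⟨ sym sc ⟩
      L a      ≤⟨ la≤c ⟩
      c        <⟨ c<lb ⟩
      L b      ∎

  InBand : ℕ → ℕ → Fin n → Set
  InBand lo hi i = lo ≤ L i × L i ≤ hi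

  edge-level : ∀ {lo hi x z} → InBand lo hi x → InBand lo hi z → E x z →
               ∃[ c ] (lo ≤ c × c < hi × OnCrossing c x × OnCrossing c z)
  edge-level (lo≤x , _) (_ , z≤hi) (inj₁ arc@(_ , sc)) =
    _ , lo≤x , subst (_≤ _) sc z≤hi , (arc-crossing arc , inj₁ refl) , (arc-crossing arc , inj₂ refl)
  edge-level (_ , x≤hi) (lo≤z , _) (inj₂ arc@(_ , sc)) =
    _ , lo≤z , subst (_≤ _) sc x≤hi , (arc-crossing arc , inj₂ refl) , (arc-crossing arc , inj₁ refl)

  data BandWalk (lo hi : ℕ) : Fin n → Fin n → Set where
    nil  : ∀ {i} → InBand lo hi i → BandWalk lo hi i i
    cons : ∀ {i j l} → InBand lo hi i → E i j → BandWalk lo hi j l → BandWalk lo hi i l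

  start-in-band : ∀ {lo hi i j} → BandWalk lo hi i j → InBand lo hi i
  start-in-band (nil b)      = b
  start-in-band (cons b _ _) = b

  walk-in-band : ∀ {lo hi i j k} → (∀ v → InBand lo hi v) → Walk E i j k → BandWalk lo hi i j
  walk-in-band band here       = nil (band _)
  walk-in-band band (step e p) = cons (band _) e (walk-in-band band p)

  Side : ℕ → ℕ → ℕ → Fin n → Fin n → Set
  Side lo hi c z y = BandWalk lo c z y ⊎ BandWalk (suc c) hi z y

  LastCrossing : ℕ → ℕ → ℕ → Fin n → Fin n → Set
  LastCrossing lo hi c z y = ∃[ z′ ] (OnCrossing c z′ × Side lo hi c z′ y)

  extend : ∀ {lo hi c z j y} → InBand lo hi z → E z j → Side lo hi c j y →
           Side lo hi c z y ⊎ LastCrossing lo hi c z y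
  extend {c = c} {z} (lo≤z , _) e (inj₁ low) with L z ≤? c
  ... | yes z≤c = inj₁ (inj₁ (cons (lo≤z , z≤c) e low))
  ... | no z≰c  = inj₂ (_ , proj₁ (edge-across (adj-sym e) (proj₂ (start-in-band low)) (≰⇒> z≰c)) , inj₁ low)
  extend {c = c} {z} (_ , z≤hi) e (inj₂ high) with L z ≤? c
  ... | yes z≤c = inj₂ (_ , proj₂ (edge-across e z≤c (proj₁ (start-in-band high))) , inj₂ high)
  ... | no z≰c  = inj₁ (inj₂ (cons (≰⇒> z≰c , z≤hi) e high))

  split-at : ∀ {lo hi z y} c → BandWalk lo hi z y → Side lo hi c z y ⊎ LastCrossing lo hi c z y
  split-at {z = z} c (nil (lo≤z , z≤hi)) with L z ≤? c
  ... | yes z≤c = inj₁ (inj₁ (nil (lo≤z , z≤c)))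
  ... | no z≰c  = inj₁ (inj₂ (nil (≰⇒> z≰c , z≤hi)))
  split-at c (cons bz e W) with split-at c W
  ... | inj₁ side = extend bz e side
  ... | inj₂ last = inj₂ last

  last-crossing : ∀ {lo hi z y} c → OnCrossing c z → BandWalk lo hi z y → LastCrossing lo hi c z y
  last-crossing c cz W with split-at c W
  ... | inj₁ side = _ , cz , side
  ... | inj₂ last = last

  band-shortcut : ∀ k {lo hi x y} → hi ≤ k + lo → BandWalk lo hi x y → DistLe E x y (k * 3)
  band-shortcut k bd (nil _) = 0 , z≤n , here
  band-shortcut k bd (cons bx e W) with edge-level bx (start-in-band W) e
  band-shortcut zero bd (cons _ _ _) | c , lo≤c , c<hi , _ =
    contradiction (≤-trans c<hi (≤-trans bd lo≤c)) (<-irrefl refl)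
  band-shortcut (suc k) {lo} {hi} {y = y} bd (cons _ _ W) | c , lo≤c , c<hi , cx , cz
    with last-crossing c cz W
  ... | z′ , cz′ , side = dist-trans (crossings-close cx cz′) (shortcut-side side)
    where
    -- Both sides of level c are bands of width ≤ k.
    shortcut-side : Side lo hi c z′ y → DistLe E z′ y (k * 3)
    shortcut-side (inj₁ low)  = band-shortcut k (s≤s⁻¹ (≤-trans c<hi bd)) low
    shortcut-side (inj₂ high) = band-shortcut k hi≤k+c+1 high
      where
      hi≤k+c+1 : hi ≤ k + suc c
      hi≤k+c+1 = subst (hi ≤_) (sym (+-suc k c)) (≤-trans bd (s≤s (+-monoʳ-≤ k lo≤c)))

three-times-pred : ∀ t → t * 3 ≡ 3 * suc t ∸ 3
three-times-pred t = sym (begin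
  3 * suc t ∸ 3 ≡⟨ cong (_∸ 3) (*-suc 3 t) ⟩
  3 + 3 * t ∸ 3 ≡⟨ m+n∸m≡n 3 (3 * t) ⟩
  3 * t         ≡⟨ *-comm 3 t ⟩
  t * 3         ∎)
  where open ≡-Reasoning

theorem5p5 : (s : ℕ) → 2 ≤ s → (m : ℕ) → (w : Word s (suc m)) →
    Connected (ParikhAdj w) → DiameterLe (ParikhAdj w) (3 * s ∸ 3)
theorem5p5 (suc t) _ m w connected i j with connected i j
... | _ , walk = dist-weaken (≤-reflexive (three-times-pred t))
                   (band-shortcut t (m≤m+n t 0) (walk-in-band letters-in-band walk))
  where
  open ParikhGraph w
  letters-in-band : ∀ v → InBand 0 t v
  letters-in-band v = z≤n , s≤s⁻¹ (toℕ<n (lookup w v))
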